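{- Let $D\in\mathcal{S}_n^k$, let $\mathcal{T}^q_\sigma$ be as defined in the context (with common vertex set $V$), and let $h:E(D)\to\mathcal{T}^q_\sigma$ be any function. Then $D\otimes_h\mathcal{T}^q_\sigma$ is edge-magic.
   Context: Digraphs may have loops but no multiple arcs. $[a,b]=\{a,\dots,b\}$. An edge-magic labeling of a $(p,q)$-(di)graph $G$ is a bijection $f:V(G)\cup E(G)\to[1,p+q]$ with $f(x)+f(xy)+f(y)=\mathrm{val}(f)$ constant over edges (the magic sum); $G$ is edge-magic if it has one; super edge-magic if moreover $f(V(G))=[1,p]$. $\mathcal{S}_n^k$: the set of digraphs $D$ with vertex set $[1,n]$ (vertices named by their labels in a super edge-magic labeling), exactly $n$ arcs, and $\{i+j:(i,j)\in E(D)\}=[k,k+n-1]$. Fix a set $V$ of $p$ positive integers and integers $q,\sigma$. $\mathcal{T}^q_\sigma$ is a family of edge-magic labeled digraphs $F$, each with vertex set $V(F)=V$ (each vertex named by its label, so $V\subseteq[1,p+q]$), with $|E(F)|=q$ and magic sum $\sigma$. For $h:E(D)\to\mathcal{T}^q_\sigma$, the digraph $D\otimes_h\mathcal{T}^q_\sigma$ has vertex set $V(D)\times V$, and $((i,a),(j,b))$ is an arc iff $(i,j)\in E(D)$ and $(a,b)\in E(h(i,j))$. -}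

module Defs where

open import Data.Nat using (ℕ; suc; _+_; _≤_; _<_)
open import Data.Product using (_×_; _,_; proj₁; proj₂)
open import Data.List using (List; []; _∷_; map; _++_; length; upTo; concat; cartesianProduct)
open import Data.List.Relation.Unary.All using (All)
open import Data.List.Relation.Unary.Unique.Propositional using (Unique)
open import Data.List.Membership.Propositional using (_∈_; mapWith∈)
open import Data.List.Relation.Binary.Permutation.Propositional using (_↭_)
open import Relation.Binary.PropositionalEquality using (_≡_)
open import Function.Bundles using (_⇔_)

[1‥_] : ℕ → List ℕ
[1‥ m ] = map suc (upTo m)

-- A finite digraph (loops allowed, no multiple arcs) given by a vertex list
-- and an arc list: both duplicate-free, arcs have endpoints among the vertices.
IsDigraph : {A : Set} → List A → List (A × A) → Set
IsDigraph vs es = Unique vs × Unique es × All (λ e → proj₁ e ∈ vs × proj₂ e ∈ vs) es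

-- Edge-magic labeling of the (p,q)-digraph (vs, es), p = length vs, q = length es:
-- the labels of vertices and arcs together form a bijection onto [1, p+q]
-- (as vs and es are duplicate-free, this is a permutation of [1, p+q]),
-- and f(x) + f(xy) + f(y) is constant (= val) over all arcs.
record EdgeMagicLabeling {A : Set} (vs : List A) (es : List (A × A)) : Set where
  field
    fV    : A → ℕ
    fE    : A × A → ℕ
    bij   : (map fV vs ++ map fE es) ↭ [1‥ length vs + length es ]
    val   : ℕ
    magic : All (λ e → fV (proj₁ e) + fE e + fV (proj₂ e) ≡ val) es
open EdgeMagicLabeling public

EdgeMagic : {A : Set} → List A → List (A × A) → Set
EdgeMagic vs es = EdgeMagicLabeling vs es

record SuperEdgeMagicLabeling {A : Set} (vs : List A) (es : List (A × A)) : Set where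
  field
    lab   : EdgeMagicLabeling vs es
    super : map (fV lab) vs ↭ [1‥ length vs ]
open SuperEdgeMagicLabeling public

-- D = (vs, es) ∈ S_n^k : vertex set [1,n], vertices named by their labels in a
-- super edge-magic labeling, exactly n arcs, and {i+j : (i,j) ∈ E(D)} = [k, k+n-1].
record InS (n k : ℕ) (vs : List ℕ) (es : List (ℕ × ℕ)) : Set where
  field
    digraph  : IsDigraph vs es
    vertSet  : vs ↭ [1‥ n ]
    sel      : SuperEdgeMagicLabeling vs es
    named    : All (λ v → fV (lab sel) v ≡ v) vs
    arcCount : length es ≡ n
    sums     : ∀ s → (s ∈ map (λ e → proj₁ e + proj₂ e) es) ⇔ (k ≤ s × s < k + n)

-- A member F of the family T^q_σ (common vertex set V): an edge-magic labeled
-- digraph with vertex set V, each vertex named by its label, q arcs, magic sum σ.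
record TMember (V : List ℕ) (q σ : ℕ) : Set where
  field
    arcsF   : List (ℕ × ℕ)
    isDi    : IsDigraph V arcsF
    arcsLen : length arcsF ≡ q
    labF    : EdgeMagicLabeling V arcsF
    namedF  : All (λ v → fV labF v ≡ v) V
    sumF    : val labF ≡ σ
open TMember public

-- D ⊗_h T^q_σ : vertex set V(D) × V; ((i,a),(j,b)) is an arc iff
-- (i,j) ∈ E(D) and (a,b) ∈ E(h(i,j)).
⊗V : List ℕ → List ℕ → List (ℕ × ℕ)
⊗V vs V = cartesianProduct vs V

⊗E : {V : List ℕ} {q σ : ℕ} (es : List (ℕ × ℕ)) →
     (h : ∀ {e} → e ∈ es → TMember V q σ) → List ((ℕ × ℕ) × (ℕ × ℕ))
⊗E es h = concat (mapWith∈ es (λ {e} p →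
  map (λ ab → ((proj₁ e , proj₁ ab) , (proj₂ e , proj₂ ab))) (arcsF (h p))))

-- The super edge-magic labeling of D, with vertices named by their labels, gives
-- the arcs of D the labels n+1, …, 2n; subtracting n numbers the arcs 1, …, n.
-- With m = |V| + q, give the vertex (i, a) the label (i−1)m + a and the arc lifted
-- from e = (i, j) and (a, b) ∈ h(e) the label (s−1)m + c, where s is the number of e
-- and c the label of (a, b) in h(e).  Row s of the n × m grid of labels then
-- receives the vertices (s, a) and the arcs lifted from the arc e numbered s, and
-- it is filled exactly because V together with the arc labels of h(e) is [1, m].
-- The sum along a lifted arc is (i + s + j − 3)m + σ, and i + s + j = val(D) − n.

module Submission where

open import Defs
open import Data.Nat using (ℕ; zero; suc; _+_; _*_; _∸_; _≤_; _<_; s≤s; z≤n)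
open import Data.Nat.Properties
  using (_≟_; +-comm; +-∸-assoc; +-∸-comm; m+n∸m≡n; m≤n+m; m<n⇒0<n∸m; m<m+n; <⇒≤; ≤-trans)
open import Data.Nat.Tactic.RingSolver using (solve-∀)
open import Data.Product using (_×_; _,_; proj₁; proj₂; uncurry)
open import Data.Product.Properties using (≡-dec)
open import Data.List
  using (List; []; _∷_; [_]; map; _++_; concat; length; upTo; cartesianProduct)
open import Data.List.Properties
  using (map-id; map-∘; map-++; map-upTo; map-cong; map-id-local; concat-map; concat-++;
         ++-identityʳ; ++-assoc; upTo-∷ʳ; length-++; length-map; length-upTo)
open import Data.List.Relation.Unary.Any using (here; there)
open import Data.List.Relation.Unary.All using (All; []; _∷_; lookup; tabulate)
import Data.List.Relation.Unary.All.Properties as All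
open import Data.List.Relation.Unary.Unique.Propositional using (Unique)
open import Data.List.Membership.Propositional using (_∈_; mapWith∈)
open import Data.List.Membership.Propositional.Properties
  using (∈-map⁺; ∈-map⁻; mapWith∈≗map; mapWith∈-cong; map-mapWith∈)
open import Data.List.Membership.Propositional.Properties.WithK using (unique⇒irrelevant)
open import Data.List.Membership.DecPropositional (≡-dec _≟_ _≟_) using (_∈?_)
open import Data.List.Relation.Binary.Permutation.Propositional as ↭
  using (_↭_; ↭-refl; ↭-sym; ↭-trans; ↭-reflexive; module PermutationReasoning)
open import Data.List.Relation.Binary.Permutation.Propositional.Properties
  using (++⁺; ++⁺ˡ; ++⁺ʳ; map⁺; shifts; drop-∷; ↭-length; ∈-resp-↭)
open import Relation.Binary.PropositionalEquality
  using (_≡_; refl; sym; trans; cong; cong₂; subst; module ≡-Reasoning)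
open import Relation.Nullary using (Dec; yes; no)
open import Data.Empty using (⊥-elim)
open import Function using (_∘_)

module _ {A : Set} where

  concat⁺ : {xss yss : List (List A)} → xss ↭ yss → concat xss ↭ concat yss
  concat⁺ ↭.refl           = ↭-refl
  concat⁺ (↭.prep xs p)    = ++⁺ˡ xs (concat⁺ p)
  concat⁺ (↭.swap xs ys p) = ↭-trans (shifts xs ys) (++⁺ˡ ys (++⁺ˡ xs (concat⁺ p)))
  concat⁺ (↭.trans p q)    = ↭-trans (concat⁺ p) (concat⁺ q)

  ++-cancelˡ : (xs : List A) {ys zs : List A} → xs ++ ys ↭ xs ++ zs → ys ↭ zs
  ++-cancelˡ []       p = p
  ++-cancelˡ (x ∷ xs) p = ++-cancelˡ xs (drop-∷ p)

module _ {A B : Set} where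

  concat-mapWith∈-++ : (xs : List A) (f g : ∀ {x} → x ∈ xs → List B) →
    concat (mapWith∈ xs f) ++ concat (mapWith∈ xs g) ↭ concat (mapWith∈ xs (λ p → f p ++ g p))
  concat-mapWith∈-++ []       f g = ↭-refl
  concat-mapWith∈-++ (x ∷ xs) f g = begin
    (f₀ ++ F) ++ g₀ ++ G  ≡⟨ ++-assoc f₀ F (g₀ ++ G) ⟩
    f₀ ++ F ++ g₀ ++ G    ↭⟨ ++⁺ˡ f₀ (shifts F g₀) ⟩
    f₀ ++ g₀ ++ F ++ G    ↭⟨ ++⁺ˡ f₀ (++⁺ˡ g₀ (concat-mapWith∈-++ xs (f ∘ there) (g ∘ there))) ⟩
    f₀ ++ g₀ ++ FG        ≡⟨ sym (++-assoc f₀ g₀ FG) ⟩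
    (f₀ ++ g₀) ++ FG      ∎
    where
    open PermutationReasoning
    f₀ g₀ F G FG : List B
    f₀ = f (here refl)
    g₀ = g (here refl)
    F = concat (mapWith∈ xs (f ∘ there))
    G = concat (mapWith∈ xs (g ∘ there))
    FG = concat (mapWith∈ xs (λ p → f (there p) ++ g (there p)))

  concat-mapWith∈⁺ : (xs : List A) {f g : ∀ {x} → x ∈ xs → List B} →
    (∀ {x} (p : x ∈ xs) → f p ↭ g p) → concat (mapWith∈ xs f) ↭ concat (mapWith∈ xs g)
  concat-mapWith∈⁺ []       fg = ↭-refl
  concat-mapWith∈⁺ (x ∷ xs) fg = ++⁺ (fg (here refl)) (concat-mapWith∈⁺ xs (fg ∘ there))

  All-mapWith∈⁺ : {P : B → Set} (xs : List A) {f : ∀ {x} → x ∈ xs → B} →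
    (∀ {x} (p : x ∈ xs) → P (f p)) → All P (mapWith∈ xs f)
  All-mapWith∈⁺ []       Pf = []
  All-mapWith∈⁺ (x ∷ xs) Pf = Pf (here refl) ∷ All-mapWith∈⁺ xs (Pf ∘ there)

  map-cartesianProduct : {C : Set} (f : A → B → C) (xs : List A) (ys : List B) →
    map (uncurry f) (cartesianProduct xs ys) ≡ concat (map (λ x → map (f x) ys) xs)
  map-cartesianProduct f []       ys = refl
  map-cartesianProduct f (x ∷ xs) ys =
    trans (map-++ (uncurry f) (map (x ,_) ys) _)
          (cong₂ _++_ (sym (map-∘ ys)) (map-cartesianProduct f xs ys))

[1‥suc] : ∀ a → [1‥ suc a ] ≡ 1 ∷ map suc [1‥ a ]
[1‥suc] a = cong (λ xs → 1 ∷ map suc xs) (sym (map-upTo suc a))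

[1‥+] : ∀ a b → [1‥ a + b ] ≡ [1‥ a ] ++ map (a +_) [1‥ b ]
[1‥+] zero    b = sym (map-id [1‥ b ])
[1‥+] (suc a) b = begin
  [1‥ suc (a + b) ]                                    ≡⟨ [1‥suc] (a + b) ⟩
  1 ∷ map suc [1‥ a + b ]                               ≡⟨ cong (λ xs → 1 ∷ map suc xs) ([1‥+] a b) ⟩
  1 ∷ map suc ([1‥ a ] ++ map (a +_) [1‥ b ])           ≡⟨ cong (1 ∷_) (map-++ suc [1‥ a ] _) ⟩
  1 ∷ map suc [1‥ a ] ++ map suc (map (a +_) [1‥ b ])   ≡⟨ cong (λ xs → 1 ∷ map suc [1‥ a ] ++ xs) (sym (map-∘ [1‥ b ])) ⟩
  1 ∷ map suc [1‥ a ] ++ map (suc a +_) [1‥ b ]         ≡⟨ cong (_++ map (suc a +_) [1‥ b ]) (sym ([1‥suc] a)) ⟩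
  [1‥ suc a ] ++ map (suc a +_) [1‥ b ]                 ∎
  where open ≡-Reasoning

length-[1‥] : ∀ k → length [1‥ k ] ≡ k
length-[1‥] k = trans (length-map suc (upTo k)) (length-upTo k)

∈-[1‥]⇒0< : ∀ {x k} → x ∈ [1‥ k ] → 0 < x
∈-[1‥]⇒0< x∈ with ∈-map⁻ suc x∈
... | _ , _ , refl = s≤s z≤n

↭-[1‥length] : {xs : List ℕ} {k : ℕ} → xs ↭ [1‥ k ] → xs ↭ [1‥ length xs ]
↭-[1‥length] {xs} {k} p =
  subst (λ l → xs ↭ [1‥ l ]) (sym (trans (↭-length p) (length-[1‥] k))) p

-- Rows r and columns x are numbered from 1.
block : ℕ → ℕ → ℕ → ℕ
block m r x = (r ∸ 1) * m + x

grid : ∀ m n → concat (map (λ r → map (block m r) [1‥ m ]) [1‥ n ]) ≡ [1‥ n * m ]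
grid m n = trans (cong concat (sym (map-∘ (upTo n)))) (rows n)
  where
  open ≡-Reasoning
  row : ℕ → List ℕ
  row r = map (r * m +_) [1‥ m ]
  rows : ∀ n → concat (map row (upTo n)) ≡ [1‥ n * m ]
  rows zero    = refl
  rows (suc n) = begin
    concat (map row (upTo (suc n)))            ≡⟨ cong (concat ∘ map row) (sym (upTo-∷ʳ n)) ⟩
    concat (map row (upTo n ++ [ n ]))          ≡⟨ cong concat (map-++ row (upTo n) [ n ]) ⟩
    concat (map row (upTo n) ++ [ row n ])      ≡⟨ sym (concat-++ (map row (upTo n)) [ row n ]) ⟩
    concat (map row (upTo n)) ++ row n ++ []    ≡⟨ cong₂ _++_ (rows n) (++-identityʳ (row n)) ⟩
    [1‥ n * m ] ++ map (n * m +_) [1‥ m ]       ≡⟨ sym ([1‥+] (n * m) m) ⟩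
    [1‥ n * m + m ]                             ≡⟨ cong [1‥_] (+-comm (n * m) m) ⟩
    [1‥ suc n * m ]                             ∎

block-+ : ∀ m {r s t} → 0 < r → 0 < s → 0 < t → ∀ a b c →
  block m r a + block m s b + block m t c ≡ block m (r + s + t ∸ 2) (a + b + c)
block-+ m {suc r} {suc s} {suc t} _ _ _ a b c = begin
  (r * m + a) + (s * m + b) + (t * m + c)          ≡⟨ regroup r s t m a b c ⟩
  (r + s + t) * m + (a + b + c)                    ≡⟨ cong (λ u → block m (suc u ∸ 2) (a + b + c)) (sym (+-suc-suc r s t)) ⟩
  block m (suc r + suc s + suc t ∸ 2) (a + b + c)  ∎
  where
  open ≡-Reasoning
  regroup : ∀ r s t m a b c → (r * m + a) + (s * m + b) + (t * m + c) ≡ (r + s + t) * m + (a + b + c)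
  regroup = solve-∀
  +-suc-suc : ∀ r s t → r + suc s + suc t ≡ suc (suc (r + s + t))
  +-suc-suc = solve-∀

named-magic : {vs : List ℕ} {es : List (ℕ × ℕ)} → IsDigraph vs es →
  (L : EdgeMagicLabeling vs es) → All (λ v → fV L v ≡ v) vs →
  ∀ {e} → e ∈ es → proj₁ e + fE L e + proj₂ e ≡ val L
named-magic {vs} (_ , _ , ends) L named {e} e∈ =
  trans (cong₂ (λ x y → x + fE L e + y) (sym (lookup named i∈)) (sym (lookup named j∈)))
        (lookup (magic L) e∈)
  where
  i∈ : proj₁ e ∈ vs
  i∈ = proj₁ (lookup ends e∈)
  j∈ : proj₂ e ∈ vs
  j∈ = proj₂ (lookup ends e∈)

module _ {A : Set} {vs : List A} {es : List (A × A)} (L : SuperEdgeMagicLabeling vs es) where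

  arcLabels-↭ : map (fE (lab L)) es ↭ map (length vs +_) [1‥ length es ]
  arcLabels-↭ = ++-cancelˡ [1‥ length vs ] (begin
    [1‥ length vs ] ++ map (fE (lab L)) es                    ↭⟨ ++⁺ʳ _ (↭-sym (super L)) ⟩
    map (fV (lab L)) vs ++ map (fE (lab L)) es                ↭⟨ bij (lab L) ⟩
    [1‥ length vs + length es ]                               ≡⟨ [1‥+] (length vs) (length es) ⟩
    [1‥ length vs ] ++ map (length vs +_) [1‥ length es ]     ∎)
    where open PermutationReasoning

  length<arcLabel : ∀ {e} → e ∈ es → length vs < fE (lab L) e
  length<arcLabel e∈ with ∈-map⁻ (length vs +_) (∈-resp-↭ arcLabels-↭ (∈-map⁺ (fE (lab L)) e∈))
  ... | r , r∈ , eq = subst (length vs <_) (sym eq) (m<m+n (length vs) (∈-[1‥]⇒0< r∈))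

  shiftedArcLabels-↭ : map (λ e → fE (lab L) e ∸ length vs) es ↭ [1‥ length es ]
  shiftedArcLabels-↭ = begin
    map (λ e → fE (lab L) e ∸ length vs) es                       ≡⟨ map-∘ es ⟩
    map (_∸ length vs) (map (fE (lab L)) es)                       ↭⟨ map⁺ (_∸ length vs) arcLabels-↭ ⟩
    map (_∸ length vs) (map (length vs +_) [1‥ length es ])        ≡⟨ sym (map-∘ [1‥ length es ]) ⟩
    map (λ x → length vs + x ∸ length vs) [1‥ length es ]          ≡⟨ map-cong (m+n∸m≡n (length vs)) [1‥ length es ] ⟩
    map (λ x → x) [1‥ length es ]                                  ≡⟨ map-id [1‥ length es ] ⟩
    [1‥ length es ]                                                ∎
    where open PermutationReasoning

TMember-labels : ∀ {V q σ} (F : TMember V q σ) → V ++ map (fE (labF F)) (arcsF F) ↭ [1‥ length V + q ]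
TMember-labels {V} F =
  subst (λ l → V ++ arcLabels ↭ [1‥ length V + l ]) (arcsLen F)
    (subst (λ vl → vl ++ arcLabels ↭ [1‥ length V + length (arcsF F) ]) (map-id-local (namedF F))
      (bij (labF F)))
  where
  arcLabels : List ℕ
  arcLabels = map (fE (labF F)) (arcsF F)

module ProductLabelling {n k : ℕ} {vs : List ℕ} {es : List (ℕ × ℕ)} (D : InS n k vs es)
                        {V : List ℕ} {q σ : ℕ} (h : ∀ {e} → e ∈ es → TMember V q σ) where

  open InS D

  m : ℕ
  m = length V + q

  shift : ℕ × ℕ → ℕ
  shift e = fE (lab sel) e ∸ length vs

  shift-↭ : map shift es ↭ [1‥ n ]
  shift-↭ = subst (λ l → map shift es ↭ [1‥ l ]) arcCount (shiftedArcLabels-↭ sel)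

  labelsOf : ∀ {e} → e ∈ es → List ℕ
  labelsOf p = map (fE (labF (h p))) (arcsF (h p))

  liftArc : ℕ × ℕ → ℕ × ℕ → (ℕ × ℕ) × (ℕ × ℕ)
  liftArc e ab = ((proj₁ e , proj₁ ab) , (proj₂ e , proj₂ ab))

  ⊗fV : ℕ × ℕ → ℕ
  ⊗fV = uncurry (block m)

  -- 0 is a junk value: only lifted arcs are ever labelled.
  arcLabel : (e : ℕ × ℕ) → Dec (e ∈ es) → ℕ × ℕ → ℕ
  arcLabel e (yes p) ab = block m (shift e) (fE (labF (h p)) ab)
  arcLabel e (no _)  _  = 0

  ⊗fE : (ℕ × ℕ) × (ℕ × ℕ) → ℕ
  ⊗fE ((i , a) , (j , b)) = arcLabel (i , j) ((i , j) ∈? es) (a , b)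

  ⊗fE-liftArc : ∀ {e} (p : e ∈ es) ab → ⊗fE (liftArc e ab) ≡ block m (shift e) (fE (labF (h p)) ab)
  ⊗fE-liftArc {e} p ab with e ∈? es
  ... | yes p′ = cong (λ p → block m (shift e) (fE (labF (h p)) ab))
                      (unique⇒irrelevant (proj₁ (proj₂ digraph)) p′ p)
  ... | no e∉  = ⊥-elim (e∉ p)

  vertexLabels-↭ : map ⊗fV (⊗V vs V) ↭ concat (mapWith∈ es (λ {e} _ → map (block m (shift e)) V))
  vertexLabels-↭ = begin
    map ⊗fV (cartesianProduct vs V)        ≡⟨ map-cartesianProduct (block m) vs V ⟩
    concat (map row vs)                    ↭⟨ concat⁺ (map⁺ row (↭-trans vertSet (↭-sym shift-↭))) ⟩
    concat (map row (map shift es))        ≡⟨ cong concat (sym (map-∘ es)) ⟩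
    concat (map (row ∘ shift) es)          ≡⟨ cong concat (sym (mapWith∈≗map (row ∘ shift) es)) ⟩
    concat (mapWith∈ es (λ {e} _ → row (shift e))) ∎
    where
    open PermutationReasoning
    row : ℕ → List ℕ
    row r = map (block m r) V

  arcLabels-≡ : map ⊗fE (⊗E es h) ≡ concat (mapWith∈ es (λ {e} p → map (block m (shift e)) (labelsOf p)))
  arcLabels-≡ = begin
    map ⊗fE (concat (mapWith∈ es arcs))           ≡⟨ sym (concat-map (mapWith∈ es arcs)) ⟩
    concat (map (map ⊗fE) (mapWith∈ es arcs))     ≡⟨ cong concat (map-mapWith∈ es arcs (map ⊗fE)) ⟩
    concat (mapWith∈ es (map ⊗fE ∘ arcs))         ≡⟨ cong concat (mapWith∈-cong es _ _ relabel) ⟩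
    concat (mapWith∈ es (λ {e} p → map (block m (shift e)) (labelsOf p))) ∎
    where
    open ≡-Reasoning
    arcs : ∀ {e} → e ∈ es → List ((ℕ × ℕ) × (ℕ × ℕ))
    arcs {e} p = map (liftArc e) (arcsF (h p))
    relabel : ∀ {e} (p : e ∈ es) → map ⊗fE (arcs p) ≡ map (block m (shift e)) (labelsOf p)
    relabel {e} p = begin
      map ⊗fE (map (liftArc e) (arcsF (h p)))                   ≡⟨ sym (map-∘ (arcsF (h p))) ⟩
      map (⊗fE ∘ liftArc e) (arcsF (h p))                       ≡⟨ map-cong (⊗fE-liftArc p) (arcsF (h p)) ⟩
      map (block m (shift e) ∘ fE (labF (h p))) (arcsF (h p))   ≡⟨ map-∘ (arcsF (h p)) ⟩
      map (block m (shift e)) (labelsOf p)                      ∎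

  labels-↭ : map ⊗fV (⊗V vs V) ++ map ⊗fE (⊗E es h) ↭ [1‥ n * m ]
  labels-↭ = begin
    map ⊗fV (⊗V vs V) ++ map ⊗fE (⊗E es h)
      ↭⟨ ++⁺ vertexLabels-↭ (↭-reflexive arcLabels-≡) ⟩
    concat (mapWith∈ es (λ {e} _ → row e V)) ++ concat (mapWith∈ es (λ {e} p → row e (labelsOf p)))
      ↭⟨ concat-mapWith∈-++ es _ _ ⟩
    concat (mapWith∈ es (λ {e} p → row e V ++ row e (labelsOf p)))
      ↭⟨ concat-mapWith∈⁺ es block-↭ ⟩
    concat (mapWith∈ es (λ {e} _ → row e [1‥ m ]))
      ≡⟨ cong concat (mapWith∈≗map (λ e → row e [1‥ m ]) es) ⟩
    concat (map (λ e → row e [1‥ m ]) es)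
      ≡⟨ cong concat (map-∘ es) ⟩
    concat (map (λ r → map (block m r) [1‥ m ]) (map shift es))
      ↭⟨ concat⁺ (map⁺ (λ r → map (block m r) [1‥ m ]) shift-↭) ⟩
    concat (map (λ r → map (block m r) [1‥ m ]) [1‥ n ])
      ≡⟨ grid m n ⟩
    [1‥ n * m ] ∎
    where
    open PermutationReasoning
    row : ℕ × ℕ → List ℕ → List ℕ
    row e = map (block m (shift e))
    block-↭ : ∀ {e} (p : e ∈ es) → row e V ++ row e (labelsOf p) ↭ row e [1‥ m ]
    block-↭ {e} p = ↭-trans (↭-reflexive (sym (map-++ (block m (shift e)) V (labelsOf p))))
                            (map⁺ (block m (shift e)) (TMember-labels (h p)))

  shift-magic : ∀ {e} → e ∈ es → proj₁ e + shift e + proj₂ e ≡ val (lab sel) ∸ length vs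
  shift-magic {i , j} e∈ = begin
    i + (f ∸ p) + j   ≡⟨ cong (_+ j) (sym (+-∸-assoc i p≤f)) ⟩
    (i + f ∸ p) + j   ≡⟨ sym (+-∸-comm j (≤-trans p≤f (m≤n+m f i))) ⟩
    i + f + j ∸ p     ≡⟨ cong (_∸ p) (named-magic digraph (lab sel) named e∈) ⟩
    val (lab sel) ∸ p ∎
    where
    open ≡-Reasoning
    p f : ℕ
    p = length vs
    f = fE (lab sel) (i , j)
    p≤f : p ≤ f
    p≤f = <⇒≤ (length<arcLabel sel e∈)

  ⊗val : ℕ
  ⊗val = block m (val (lab sel) ∸ length vs ∸ 2) σ

  ⊗-magic : ∀ {e} (p : e ∈ es) {ab} → ab ∈ arcsF (h p) →
    ⊗fV (proj₁ (liftArc e ab)) + ⊗fE (liftArc e ab) + ⊗fV (proj₂ (liftArc e ab)) ≡ ⊗val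
  ⊗-magic {i , j} p {a , b} ab∈ = begin
    block m i a + ⊗fE (liftArc (i , j) (a , b)) + block m j b
      ≡⟨ cong (λ x → block m i a + x + block m j b) (⊗fE-liftArc p (a , b)) ⟩
    block m i a + block m (shift (i , j)) c + block m j b
      ≡⟨ block-+ m (vertex>0 i∈) (m<n⇒0<n∸m (length<arcLabel sel p)) (vertex>0 j∈) a c b ⟩
    block m (i + shift (i , j) + j ∸ 2) (a + c + b)
      ≡⟨ cong₂ (λ r x → block m (r ∸ 2) x) (shift-magic p) F-magic ⟩
    ⊗val ∎
    where
    open ≡-Reasoning
    F : TMember V q σ
    F = h p
    c : ℕ
    c = fE (labF F) (a , b)
    F-magic : a + c + b ≡ σ
    F-magic = trans (named-magic (isDi F) (labF F) (namedF F) ab∈) (sumF F)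
    vertex>0 : ∀ {v} → v ∈ vs → 0 < v
    vertex>0 v∈ = ∈-[1‥]⇒0< (∈-resp-↭ vertSet v∈)
    i∈ : i ∈ vs
    i∈ = proj₁ (lookup (proj₂ (proj₂ digraph)) p)
    j∈ : j ∈ vs
    j∈ = proj₂ (lookup (proj₂ (proj₂ digraph)) p)

  ⊗-labelling : EdgeMagicLabeling (⊗V vs V) (⊗E es h)
  ⊗-labelling = record
    { fV    = ⊗fV
    ; fE    = ⊗fE
    ; bij   = subst (λ l → labels ↭ [1‥ l ]) lengths (↭-[1‥length] labels-↭)
    ; val   = ⊗val
    ; magic = All.concat⁺ (All-mapWith∈⁺ es (λ p → All.map⁺ (tabulate (⊗-magic p))))
    }
    where
    labels : List ℕ
    labels = map ⊗fV (⊗V vs V) ++ map ⊗fE (⊗E es h)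
    lengths : length labels ≡ length (⊗V vs V) + length (⊗E es h)
    lengths = trans (length-++ (map ⊗fV (⊗V vs V)))
                    (cong₂ _+_ (length-map ⊗fV (⊗V vs V)) (length-map ⊗fE (⊗E es h)))

theorem3p1 : (n k : ℕ) (vs : List ℕ) (es : List (ℕ × ℕ)) → InS n k vs es →
    (V : List ℕ) → Unique V → All (λ v → 0 < v) V → (q σ : ℕ) →
    (h : ∀ {e} → e ∈ es → TMember V q σ) →
    EdgeMagic (⊗V vs V) (⊗E es h)
theorem3p1 n k vs es D V _ _ q σ h = ProductLabelling.⊗-labelling D h
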